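{- Let $G=(V,E)$ be a loopless (multi)graph with $m\ge1$ edges. Let $\mathcal{D}\subseteq\mathbb{R}^V$ be the set of orientations of $G$, $f(b)=\sum_{u\in V}b_u^2$ on $\mathcal{D}$, and $C_f$ its curvature constant. Define $b^{(0)}=\textsc{Weighted-Greedy}(G,\mathbf{0})$ and for $k\ge0$, $d^{(k+1)}=\textsc{Weighted-Greedy}(G,(k+1)b^{(k)})$ and $b^{(k+1)}=\left(1-\frac{1}{k+1}\right)b^{(k)}+\frac{1}{k+1}d^{(k+1)}$. Then there is $\delta=\Theta\!\left(\frac{\sum_{u}\deg_G(u)^2}{m}\right)$ such that for all $k\ge0$, $$\sum_{u\in V}b^{(k)}(u)d^{(k+1)}(u)\le\min_{d\in\mathcal{D}}\sum_{u\in V}b^{(k)}(u)d(u)+\frac{\delta C_f}{k+2}.$$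
   Context: An orientation: assign to each edge $uv$ numbers $x_{uv},x_{vu}\ge0$ with $x_{uv}+x_{vu}=1$; $d_u=\sum_{v:uv\in E}x_{uv}$. Curvature constant: $C_f=\sup_{x,s\in\mathcal{D},\gamma\in[0,1],y=x+\gamma(s-x)}\frac{2}{\gamma^2}(f(y)-f(x)-\langle y-x,\nabla f(x)\rangle)$. \textsc{Weighted-Greedy}$(G,w)$: set $G'=G$, $\hat d(u)=0$ for all $u$; while $G'$ has more than one vertex, pick $u$ minimizing $w(u)+\deg_{G'}(u)$, set $\hat d(u)=\deg_{G'}(u)$, delete $u$ from $G'$; return $\hat d$.
   Formalization: The set $\mathcal{D}$ of orientations is taken in ℚ^V rather than $\mathbb{R}^V$, so the minimum and the supremum defining $C_f$ run over rational orientations, and the parameter γ is rational. -}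

module Defs where

open import Data.Nat as ℕ using (ℕ; zero; suc)
open import Data.Integer using (+_)
open import Data.Fin using (Fin; zero; suc)
open import Data.Fin.Subset using (Subset; ⊤; _∈_; ∣_∣) renaming (_-_ to _∖_)
open import Data.Product using (_×_; _,_; proj₁; proj₂; Σ; ∃)
open import Data.Bool using (if_then_else_)
open import Relation.Nullary using (¬_; does)
open import Relation.Nullary.Decidable using (_×-dec_; _⊎-dec_)
open import Relation.Binary.PropositionalEquality using (_≡_; _≢_)
open import Data.Rational as ℚ using (ℚ; 0ℚ; 1ℚ; _+_; _*_; _-_; _≤_; _<_; _/_; Positive)
open import Data.Rational.Properties using (pos⇒nonZero; pos*pos⇒pos)
import Data.Fin.Properties as FinP
import Data.Fin.Subset.Properties as SubP

⟦_⟧ : ℕ → ℚ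
⟦ k ⟧ = + k / 1

Σℚ : ∀ {k} → (Fin k → ℚ) → ℚ
Σℚ {zero} f = 0ℚ
Σℚ {suc k} f = f zero + Σℚ (λ i → f (suc i))

Σℕ : ∀ {k} → (Fin k → ℕ) → ℕ
Σℕ {zero} f = 0
Σℕ {suc k} f = f zero ℕ.+ Σℕ (λ i → f (suc i))

record Graph (n : ℕ) : Set where
  field
    m        : ℕ
    ends     : Fin m → Fin n × Fin n
    loopless : ∀ e → proj₁ (ends e) ≢ proj₂ (ends e)
open Graph public

-- degree of u in the subgraph induced by S (number of edges joining u to
-- a vertex of S; for u ∈ S this is deg_{G[S]}(u) since G is loopless)
degIn : ∀ {n} → Graph n → Subset n → Fin n → ℕ
degIn G S u = Σℕ λ e →
  let a = proj₁ (ends G e) ; b = proj₂ (ends G e) in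
  if does ((FinP._≟_ a u ×-dec SubP._∈?_ b S) ⊎-dec (FinP._≟_ b u ×-dec SubP._∈?_ a S))
  then 1 else 0

deg : ∀ {n} → Graph n → Fin n → ℕ
deg G u = degIn G ⊤ u

-- Greedy G w S acc out : starting from the
-- current graph G' = G[S] and current table acc = d̂, the loop can end with
-- output out.  Any choice of minimiser is allowed (ties arbitrary).
data Greedy {n} (G : Graph n) (w : Fin n → ℚ) : Subset n → (Fin n → ℚ) → (Fin n → ℚ) → Set where
  done : ∀ {S acc out} → ∣ S ∣ ℕ.≤ 1 → (∀ v → out v ≡ acc v) → Greedy G w S acc out
  step : ∀ {S acc out} (u : Fin n) → 1 ℕ.< ∣ S ∣ → u ∈ S →
         (∀ v → v ∈ S → w u + ⟦ degIn G S u ⟧ ≤ w v + ⟦ degIn G S v ⟧) →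
         Greedy G w (S ∖ u) (λ v → if does (FinP._≟_ v u) then ⟦ degIn G S u ⟧ else acc v) out →
         Greedy G w S acc out

IsWeightedGreedy : ∀ {n} → Graph n → (Fin n → ℚ) → (Fin n → ℚ) → Set
IsWeightedGreedy G w d̂ = Greedy G w ⊤ (λ _ → 0ℚ) d̂

-- Fractional orientations: x e = x_{ab} for ends e = (a , b), x_{ba} = 1 - x e.
-- (Real numbers are unavailable; rational orientations are used.)
ValidOrientation : ∀ {n} (G : Graph n) → (Fin (m G) → ℚ) → Set
ValidOrientation G x = ∀ e → (0ℚ ≤ x e) × (x e ≤ 1ℚ)

loadOf : ∀ {n} (G : Graph n) → (Fin (m G) → ℚ) → Fin n → ℚ
loadOf G x u = Σℚ λ e →
  let a = proj₁ (ends G e) ; b = proj₂ (ends G e) in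
  (if does (FinP._≟_ a u) then x e else 0ℚ) +
  (if does (FinP._≟_ b u) then 1ℚ - x e else 0ℚ)

In𝒟 : ∀ {n} (G : Graph n) → (Fin n → ℚ) → Set
In𝒟 G d = Σ (Fin (m G) → ℚ) λ x → ValidOrientation G x × (∀ u → d u ≡ loadOf G x u)

fObj : ∀ {n} → (Fin n → ℚ) → ℚ
fObj b = Σℚ λ u → b u * b u

∇f : ∀ {n} → (Fin n → ℚ) → Fin n → ℚ
∇f b u = ⟦ 2 ⟧ * b u

⟨_,_⟩ : ∀ {n} → (Fin n → ℚ) → (Fin n → ℚ) → ℚ
⟨ a , b ⟩ = Σℚ λ u → a u * b u

curvQuot : ∀ {n} → (Fin n → ℚ) → (Fin n → ℚ) → (γ : ℚ) → .{{Positive γ}} → ℚ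
curvQuot x s γ {{pγ}} =
  let y = λ u → x u + γ * (s u - x u) in
  (⟦ 2 ⟧ ℚ.÷ (γ * γ)) {{pos⇒nonZero (γ * γ) {{pos*pos⇒pos γ {{pγ}} γ {{pγ}}}}}}
    * (fObj y - fObj x - ⟨ (λ u → y u - x u) , ∇f x ⟩)

-- C is the curvature constant C_f of f on 𝒟 (supremum over x, s ∈ 𝒟 and
-- γ ∈ (0,1]; γ = 0 makes the quotient undefined and is excluded)
CurvUpperBound : ∀ {n} → Graph n → ℚ → Set
CurvUpperBound G C = ∀ x s γ → In𝒟 G x → In𝒟 G s → (pγ : 0ℚ < γ) → γ ≤ 1ℚ →
  curvQuot x s γ {{ℚ.positive pγ}} ≤ C

IsCurvatureConstant : ∀ {n} → Graph n → ℚ → Set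
IsCurvatureConstant G C = CurvUpperBound G C × (∀ C' → CurvUpperBound G C' → C ≤ C')

-- Weighted-Greedy is a linear minimisation oracle over the orientations with additive error
-- Σ_u deg(u)²: for any weights w, greedy output d̂ and orientation d, ⟨w, d̂⟩ ≤ ⟨w, d⟩ + Σ_u deg(u)².
-- Fix the orientation x of d and charge each edge e = ab the cost x_e w_a + (1 - x_e) w_b + deg a + deg b.
-- While the greedy runs on the vertex set S, what it can still add to ⟨w, d̂⟩ is bounded by the cost of
-- the edges inside S: deleting the minimiser u of w + deg_S adds w_u per edge ua with a ∈ S, and
-- minimality gives w_u ≤ w_a + deg a, so w_u is at most the cost of ua.  At S = V the total cost is
-- ⟨w, d⟩ + Σ_e (deg a + deg b) = ⟨w, d⟩ + Σ_u deg(u)².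
-- On the other side C_f ≥ 4m: at γ = 1 the curvature quotient is 2‖s - x‖², and for an integral
-- orientation s and its reversal x, s - x = Σ_e ±(1_a - 1_b); choosing the signs one edge at a time by
-- the parallelogram law gives ‖s - x‖² ≥ Σ_e ‖1_a - 1_b‖² = 2m.
-- So with δ = Σ_u deg(u)² / m, the error Σ_u deg(u)² / (k+1) of the k-th oracle call (whose weights
-- are scaled by k+1) is at most δ C_f / (k+2).

module Submission where

open import Defs
open import Data.Bool using (Bool; true; false; not; if_then_else_)
open import Data.Fin using (Fin; zero; suc; _≟_)
open import Data.Fin.Subset using (Subset; inside; outside; ⊤; _∈_; _∉_; _⊆_; ∣_∣; ⁅_⁆) renaming (_-_ to _∖_)
open import Data.Fin.Subset.Properties
  using (_∈?_; ∈⊤; x∈⁅y⁆⇒x≡y; ∣⁅x⁆∣≡1; p⊆q⇒∣p∣≤∣q∣; x∈p⇒∣p-x∣<∣p∣; x∈p∧x≢y⇒x∈p-y; p─q⊆p)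
open import Data.Integer as ℤ using (+_)
import Data.Integer.Properties as ℤP
open import Data.Integer.Solver renaming (module +-*-Solver to ℤ-Solver)
open import Data.Nat as ℕ using (ℕ; zero; suc)
import Data.Nat.Properties as ℕP
open import Data.Nat.Coprimality using (1-coprimeTo) renaming (sym to coprime-sym)
open import Data.Nat.Solver renaming (module +-*-Solver to ℕ-Solver)
open import Data.Product as Product using (_×_; _,_; proj₁; proj₂; Σ; ∃)
open import Data.Rational as ℚ using (ℚ; 0ℚ; 1ℚ; _+_; _*_; _-_; _≤_; _<_; _/_)
import Data.Rational.Properties as ℚP
open import Data.Rational.Solver renaming (module +-*-Solver to ℚ-Solver)
import Data.Rational.Unnormalised as ℚᵘ
import Data.Rational.Unnormalised.Properties as ℚᵘP
open import Data.Sum as Sum using (_⊎_; inj₁; inj₂)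
open import Data.Vec.Base using (_∷_; here; there)
import Data.Vec.Functional as Vector
open import Function using (_∘_)
open import Relation.Binary.PropositionalEquality
  using (_≡_; _≢_; refl; sym; trans; cong; cong₂; subst; subst₂; module ≡-Reasoning)
open import Relation.Nullary using (Dec; yes; no; does; ¬_; contradiction)
open import Relation.Nullary.Decidable using (_×-dec_; _⊎-dec_)

p≤q⇒0≤q-p : ∀ {p q} → p ≤ q → 0ℚ ≤ q - p
p≤q⇒0≤q-p {p} {q} p≤q = subst (_≤ q - p) (ℚP.+-inverseʳ p) (ℚP.+-monoˡ-≤ (ℚ.- p) p≤q)

0≤q-p⇒p≤q : ∀ {p q} → 0ℚ ≤ q - p → p ≤ q
0≤q-p⇒p≤q {p} {q} 0≤q-p = subst₂ _≤_ (ℚP.+-identityʳ p)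
  (solve 2 (λ p q → p :+ (q :- p) := q) refl p q) (ℚP.+-monoʳ-≤ p 0≤q-p)
  where open ℚ-Solver hiding (⟦_⟧)

p≤p+q : ∀ {p q} → 0ℚ ≤ q → p ≤ p + q
p≤p+q {p} {q} 0≤q = subst (_≤ p + q) (ℚP.+-identityʳ p) (ℚP.+-monoʳ-≤ p 0≤q)

q≤p+q : ∀ {p q} → 0ℚ ≤ p → q ≤ p + q
q≤p+q {p} {q} 0≤p = subst (_≤ p + q) (ℚP.+-identityˡ q) (ℚP.+-monoˡ-≤ q 0≤p)

*-nonNeg : ∀ {p q} → 0ℚ ≤ p → 0ℚ ≤ q → 0ℚ ≤ p * q
*-nonNeg {p} {q} 0≤p 0≤q = subst (_≤ p * q) (ℚP.*-zeroʳ p) (ℚP.*-monoˡ-≤-nonNeg p {{ℚ.nonNegative 0≤p}} 0≤q)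

≤-convex : ∀ {p q r s t} → 0ℚ ≤ s → 0ℚ ≤ t → s + t ≡ 1ℚ → 0ℚ ≤ r →
           p ≤ q + r → p ≤ p * s + q * t + r
≤-convex {p} {q} {r} {s} {t} 0≤s 0≤t s+t≡1 0≤r p≤q+r = 0≤q-p⇒p≤q (subst (0ℚ ≤_) eq 0≤slack)
  where
  open ℚ-Solver hiding (⟦_⟧)
  0≤slack : 0ℚ ≤ t * ((q + r) - p) + s * r
  0≤slack = ℚP.+-mono-≤ (*-nonNeg 0≤t (p≤q⇒0≤q-p p≤q+r)) (*-nonNeg 0≤s 0≤r)
  s≡1-t : s ≡ 1ℚ - t
  s≡1-t = trans (solve 2 (λ s t → s := (s :+ t) :- t) refl s t) (cong (_- t) s+t≡1)
  eq : t * ((q + r) - p) + s * r ≡ p * s + q * t + r - p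
  eq = begin
    t * ((q + r) - p) + s * r           ≡⟨ cong (λ s → t * ((q + r) - p) + s * r) s≡1-t ⟩
    t * ((q + r) - p) + (1ℚ - t) * r    ≡⟨ solve 4 (λ p q r t →
      t :* ((q :+ r) :- p) :+ (con 1ℚ :- t) :* r := p :* (con 1ℚ :- t) :+ q :* t :+ r :- p) refl p q r t ⟩
    p * (1ℚ - t) + q * t + r - p        ≡⟨ cong (λ s → p * s + q * t + r - p) s≡1-t ⟨
    p * s + q * t + r - p               ∎
    where open ≡-Reasoning

t+[1-t]≡1 : ∀ t → t + (1ℚ - t) ≡ 1ℚ
t+[1-t]≡1 t = solve 1 (λ t → t :+ (con 1ℚ :- t) := con 1ℚ) refl t
  where open ℚ-Solver hiding (⟦_⟧)

x+y≡z+z⇒z≤x⊎z≤y : ∀ {x y z} → x + y ≡ z + z → z ≤ x ⊎ z ≤ y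
x+y≡z+z⇒z≤x⊎z≤y {x} {y} {z} eq with z ℚP.≤? x | z ℚP.≤? y
... | yes z≤x | _       = inj₁ z≤x
... | no  _   | yes z≤y = inj₂ z≤y
... | no  z≰x | no  z≰y =
  contradiction eq (ℚP.<⇒≢ (ℚP.+-mono-< (ℚP.≰⇒> z≰x) (ℚP.≰⇒> z≰y)))

⟦⟧-toℚᵘ : ∀ k → ℚ.toℚᵘ ⟦ k ⟧ ≡ ℚᵘ.mkℚᵘ (+ k) 0
⟦⟧-toℚᵘ k = cong ℚ.toℚᵘ (ℚP.normalize-coprime (coprime-sym (1-coprimeTo k)))

⟦⟧-homo-+ : ∀ a b → ⟦ a ℕ.+ b ⟧ ≡ ⟦ a ⟧ + ⟦ b ⟧
⟦⟧-homo-+ a b = ℚP.toℚᵘ-injective (ℚᵘP.≃-trans eq (ℚᵘP.≃-sym (ℚP.toℚᵘ-homo-+ ⟦ a ⟧ ⟦ b ⟧)))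
  where
  open ℤ-Solver using (solve; _:+_; _:*_; con; _:=_)
  eq : ℚ.toℚᵘ ⟦ a ℕ.+ b ⟧ ℚᵘ.≃ ℚ.toℚᵘ ⟦ a ⟧ ℚᵘ.+ ℚ.toℚᵘ ⟦ b ⟧
  eq rewrite ⟦⟧-toℚᵘ (a ℕ.+ b) | ⟦⟧-toℚᵘ a | ⟦⟧-toℚᵘ b =
    ℚᵘ.*≡* (solve 2 (λ x y → (x :+ y) :* con (+ 1) := (x :* con (+ 1) :+ y :* con (+ 1)) :* con (+ 1)) refl (+ a) (+ b))

⟦⟧-homo-* : ∀ a b → ⟦ a ℕ.* b ⟧ ≡ ⟦ a ⟧ * ⟦ b ⟧
⟦⟧-homo-* a b = ℚP.toℚᵘ-injective (ℚᵘP.≃-trans eq (ℚᵘP.≃-sym (ℚP.toℚᵘ-homo-* ⟦ a ⟧ ⟦ b ⟧)))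
  where
  eq : ℚ.toℚᵘ ⟦ a ℕ.* b ⟧ ℚᵘ.≃ ℚ.toℚᵘ ⟦ a ⟧ ℚᵘ.* ℚ.toℚᵘ ⟦ b ⟧
  eq rewrite ⟦⟧-toℚᵘ (a ℕ.* b) | ⟦⟧-toℚᵘ a | ⟦⟧-toℚᵘ b =
    ℚᵘ.*≡* (cong (ℤ._* + 1) (ℤP.pos-* a b))

⟦⟧-nonNeg : ∀ k → 0ℚ ≤ ⟦ k ⟧
⟦⟧-nonNeg k = ℚP.nonNegative⁻¹ ⟦ k ⟧ {{ℚP.normalize-nonNeg k 1}}

⟦⟧-pos : ∀ k .{{_ : ℕ.NonZero k}} → ℚ.Positive ⟦ k ⟧
⟦⟧-pos k = ℚP.normalize-pos k 1

⟦⟧-mono-≤ : ∀ {a b} → a ℕ.≤ b → ⟦ a ⟧ ≤ ⟦ b ⟧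
⟦⟧-mono-≤ {a} {b} a≤b = begin
  ⟦ a ⟧                ≤⟨ p≤p+q (⟦⟧-nonNeg (b ℕ.∸ a)) ⟩
  ⟦ a ⟧ + ⟦ b ℕ.∸ a ⟧  ≡⟨ ⟦⟧-homo-+ a (b ℕ.∸ a) ⟨
  ⟦ a ℕ.+ (b ℕ.∸ a) ⟧  ≡⟨ cong ⟦_⟧ (ℕP.m+[n∸m]≡n a≤b) ⟩
  ⟦ b ⟧                ∎
  where open ℚP.≤-Reasoning

when : ∀ {A : Set} → Dec A → ℚ → ℚ
when a? q = if does a? then q else 0ℚ

when-yes : ∀ {A : Set} (a? : Dec A) {q} → A → when a? q ≡ q
when-yes (yes _) _ = refl
when-yes (no ¬a) a = contradiction a ¬a

when-no : ∀ {A : Set} (a? : Dec A) {q} → ¬ A → when a? q ≡ 0ℚ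
when-no (yes a) ¬a = contradiction a ¬a
when-no (no _)  _  = refl

when-cong : ∀ {A B : Set} (a? : Dec A) (b? : Dec B) {q} → (A → B) → (B → A) → when a? q ≡ when b? q
when-cong (yes a) b?      A→B _   = sym (when-yes b? (A→B a))
when-cong (no ¬a) (yes b) _   B→A = contradiction (B→A b) ¬a
when-cong (no _)  (no _)  _   _   = refl

when-⊎-dec : ∀ {A B : Set} (a? : Dec A) (b? : Dec B) {q} → ¬ (A × B) →
  when (a? ⊎-dec b?) q ≡ when a? q + when b? q
when-⊎-dec (yes a) (yes b)     ¬a×b = contradiction (a , b) ¬a×b
when-⊎-dec (yes _) (no _)  {q} _    = sym (ℚP.+-identityʳ q)
when-⊎-dec (no _)  (yes _) {q} _    = sym (ℚP.+-identityˡ q)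
when-⊎-dec (no _)  (no _)      _    = refl

*-when : ∀ {A : Set} (a? : Dec A) (c q : ℚ) → c * when a? q ≡ when a? (c * q)
*-when (yes _) c q = refl
*-when (no _)  c q = ℚP.*-zeroʳ c

*-⟦indicator⟧ : ∀ {A : Set} (a? : Dec A) (q : ℚ) → q * ⟦ if does a? then 1 else 0 ⟧ ≡ when a? q
*-⟦indicator⟧ (yes _) q = ℚP.*-identityʳ q
*-⟦indicator⟧ (no _)  q = ℚP.*-zeroʳ q

indicator-mono : ∀ {A B : Set} → (A → B) → (a? : Dec A) (b? : Dec B) →
  (if does a? then 1 else 0) ℕ.≤ (if does b? then 1 else 0)
indicator-mono A→B (yes a) (yes _) = ℕP.≤-refl
indicator-mono A→B (yes a) (no ¬b) = contradiction (A→B a) ¬b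
indicator-mono A→B (no _)  _       = ℕ.z≤n

Σℚ-cong : ∀ {k} {f g : Fin k → ℚ} → (∀ i → f i ≡ g i) → Σℚ f ≡ Σℚ g
Σℚ-cong {zero}  f≡g = refl
Σℚ-cong {suc k} f≡g = cong₂ _+_ (f≡g zero) (Σℚ-cong (f≡g ∘ suc))

Σℚ-zero : ∀ k → Σℚ {k} (λ _ → 0ℚ) ≡ 0ℚ
Σℚ-zero zero    = refl
Σℚ-zero (suc k) = trans (ℚP.+-identityˡ _) (Σℚ-zero k)

Σℚ-distrib-+ : ∀ {k} (f g : Fin k → ℚ) → Σℚ (λ i → f i + g i) ≡ Σℚ f + Σℚ g
Σℚ-distrib-+ {zero}  f g = refl
Σℚ-distrib-+ {suc k} f g =
  trans (cong (_+_ (f zero + g zero)) (Σℚ-distrib-+ (f ∘ suc) (g ∘ suc)))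
        (solve 4 (λ a b c d → (a :+ b) :+ (c :+ d) := (a :+ c) :+ (b :+ d)) refl
               (f zero) (g zero) (Σℚ (f ∘ suc)) (Σℚ (g ∘ suc)))
  where open ℚ-Solver hiding (⟦_⟧)

Σℚ-distrib-minus : ∀ {k} (f g : Fin k → ℚ) → Σℚ (λ i → f i - g i) ≡ Σℚ f - Σℚ g
Σℚ-distrib-minus {zero}  f g = refl
Σℚ-distrib-minus {suc k} f g =
  trans (cong (_+_ (f zero - g zero)) (Σℚ-distrib-minus (f ∘ suc) (g ∘ suc)))
        (solve 4 (λ a b c d → (a :- b) :+ (c :- d) := (a :+ c) :- (b :+ d)) refl
               (f zero) (g zero) (Σℚ (f ∘ suc)) (Σℚ (g ∘ suc)))
  where open ℚ-Solver hiding (⟦_⟧)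

*-distribˡ-Σℚ : ∀ {k} (c : ℚ) (f : Fin k → ℚ) → Σℚ (λ i → c * f i) ≡ c * Σℚ f
*-distribˡ-Σℚ {zero}  c f = sym (ℚP.*-zeroʳ c)
*-distribˡ-Σℚ {suc k} c f =
  trans (cong (_+_ (c * f zero)) (*-distribˡ-Σℚ c (f ∘ suc))) (sym (ℚP.*-distribˡ-+ c (f zero) _))

Σℚ-mono-≤ : ∀ {k} {f g : Fin k → ℚ} → (∀ i → f i ≤ g i) → Σℚ f ≤ Σℚ g
Σℚ-mono-≤ {zero}  f≤g = ℚP.≤-refl
Σℚ-mono-≤ {suc k} f≤g = ℚP.+-mono-≤ (f≤g zero) (Σℚ-mono-≤ (f≤g ∘ suc))

Σℚ-swap : ∀ {k l} (F : Fin k → Fin l → ℚ) → Σℚ (λ i → Σℚ (F i)) ≡ Σℚ (λ j → Σℚ (λ i → F i j))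
Σℚ-swap {zero}  {l} F = sym (Σℚ-zero l)
Σℚ-swap {suc k} {l} F =
  trans (cong (_+_ (Σℚ (F zero))) (Σℚ-swap (F ∘ suc))) (sym (Σℚ-distrib-+ (F zero) _))

Σℚ-select : ∀ {k} (a : Fin k) (g : Fin k → ℚ) → Σℚ (λ v → when (a ≟ v) (g v)) ≡ g a
Σℚ-select {suc k} zero    g = trans (cong (_+_ (g zero)) (Σℚ-zero k)) (ℚP.+-identityʳ (g zero))
Σℚ-select {suc k} (suc a) g = trans (ℚP.+-identityˡ _) (Σℚ-select a (g ∘ suc))

⟦Σℕ⟧ : ∀ {k} (f : Fin k → ℕ) → ⟦ Σℕ f ⟧ ≡ Σℚ (λ i → ⟦ f i ⟧)
⟦Σℕ⟧ {zero}  f = refl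
⟦Σℕ⟧ {suc k} f = trans (⟦⟧-homo-+ (f zero) _) (cong (_+_ ⟦ f zero ⟧) (⟦Σℕ⟧ (f ∘ suc)))

Σℕ-mono-≤ : ∀ {k} {f g : Fin k → ℕ} → (∀ i → f i ℕ.≤ g i) → Σℕ f ℕ.≤ Σℕ g
Σℕ-mono-≤ {zero}  f≤g = ℕ.z≤n
Σℕ-mono-≤ {suc k} f≤g = ℕP.+-mono-≤ (f≤g zero) (Σℕ-mono-≤ (f≤g ∘ suc))

Σℚ-const : ∀ k (c : ℚ) → Σℚ {k} (λ _ → c) ≡ ⟦ k ⟧ * c
Σℚ-const zero    c = sym (ℚP.*-zeroˡ c)
Σℚ-const (suc k) c = begin
  c + Σℚ {k} (λ _ → c)  ≡⟨ cong (_+_ c) (Σℚ-const k c) ⟩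
  c + ⟦ k ⟧ * c         ≡⟨ cong (_+ ⟦ k ⟧ * c) (ℚP.*-identityˡ c) ⟨
  1ℚ * c + ⟦ k ⟧ * c    ≡⟨ ℚP.*-distribʳ-+ c 1ℚ ⟦ k ⟧ ⟨
  (1ℚ + ⟦ k ⟧) * c      ≡⟨ cong (_* c) (⟦⟧-homo-+ 1 k) ⟨
  ⟦ suc k ⟧ * c         ∎
  where open ≡-Reasoning

x∉p∖x : ∀ {n} (p : Subset n) x → x ∉ p ∖ x
x∉p∖x (inside  ∷ p) zero    ()
x∉p∖x (outside ∷ p) zero    ()
x∉p∖x (_       ∷ p) (suc x) (there x∈p∖x) = x∉p∖x p x x∈p∖x

x∈p∖y⇒x≢y : ∀ {n} {p : Subset n} {x y} → x ∈ p ∖ y → x ≢ y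
x∈p∖y⇒x≢y {p = p} {y = y} x∈p∖y refl = x∉p∖x p y x∈p∖y

distinct-members⇒1<∣p∣ : ∀ {n} {p : Subset n} {x y} → x ∈ p → y ∈ p → x ≢ y → 1 ℕ.< ∣ p ∣
distinct-members⇒1<∣p∣ {p = p} {x} {y} x∈p y∈p x≢y = ℕP.≤-<-trans ∣⁅y⁆∣≤∣p∖x∣ (x∈p⇒∣p-x∣<∣p∣ x∈p)
  where
  ⁅y⁆⊆p∖x : ⁅ y ⁆ ⊆ p ∖ x
  ⁅y⁆⊆p∖x z∈⁅y⁆ with refl ← x∈⁅y⁆⇒x≡y y z∈⁅y⁆ = x∈p∧x≢y⇒x∈p-y y∈p (x≢y ∘ sym)
  ∣⁅y⁆∣≤∣p∖x∣ : 1 ℕ.≤ ∣ p ∖ x ∣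
  ∣⁅y⁆∣≤∣p∖x∣ = subst (ℕ._≤ ∣ p ∖ x ∣) (∣⁅x⁆∣≡1 y) (p⊆q⇒∣p∣≤∣q∣ ⁅y⁆⊆p∖x)

update-vanishes-on-∖ : ∀ {n} {S : Subset n} {u} (acc : Fin n → ℚ) D → (∀ v → v ∈ S → acc v ≡ 0ℚ) →
  ∀ v → v ∈ S ∖ u → (if does (v ≟ u) then D else acc v) ≡ 0ℚ
update-vanishes-on-∖ {u = u} acc D acc≡0 v v∈S∖u with v ≟ u
... | yes v≡u = contradiction v≡u (x∈p∖y⇒x≢y v∈S∖u)
... | no _    = acc≡0 v (p─q⊆p _ ⁅ u ⁆ v∈S∖u)

sign : Bool → ℚ
sign true  = 1ℚ
sign false = ℚ.- 1ℚ

signedSum : ∀ {n k} → (Fin k → Bool) → (Fin k → Fin n → ℚ) → Fin n → ℚ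
signedSum σ q u = Σℚ λ e → sign (σ e) * q e u

parallelogram-law : ∀ {n} (p r : Fin n → ℚ) →
  let v = λ c u → sign c * r u + p u in
  ⟨ v true , v true ⟩ + ⟨ v false , v false ⟩ ≡ (⟨ r , r ⟩ + ⟨ p , p ⟩) + (⟨ r , r ⟩ + ⟨ p , p ⟩)
parallelogram-law p r = begin
  ⟨ v true , v true ⟩ + ⟨ v false , v false ⟩
    ≡⟨ Σℚ-distrib-+ (λ u → v true u * v true u) (λ u → v false u * v false u) ⟨
  Σℚ (λ u → v true u * v true u + v false u * v false u)
    ≡⟨ Σℚ-cong (λ u → solve 2 (λ p r →
         (con 1ℚ :* r :+ p) :* (con 1ℚ :* r :+ p) :+ (:- con 1ℚ :* r :+ p) :* (:- con 1ℚ :* r :+ p)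
         := (r :* r :+ p :* p) :+ (r :* r :+ p :* p)) refl (p u) (r u)) ⟩
  Σℚ (λ u → (r u * r u + p u * p u) + (r u * r u + p u * p u))
    ≡⟨ Σℚ-distrib-+ (λ u → r u * r u + p u * p u) (λ u → r u * r u + p u * p u) ⟩
  Σℚ (λ u → r u * r u + p u * p u) + Σℚ (λ u → r u * r u + p u * p u)
    ≡⟨ cong₂ _+_ (Σℚ-distrib-+ (λ u → r u * r u) (λ u → p u * p u)) (Σℚ-distrib-+ (λ u → r u * r u) (λ u → p u * p u)) ⟩
  (⟨ r , r ⟩ + ⟨ p , p ⟩) + (⟨ r , r ⟩ + ⟨ p , p ⟩) ∎
  where
  open ≡-Reasoning
  open ℚ-Solver hiding (⟦_⟧)
  v = λ c u → sign c * r u + p u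

∃-signs-Σ‖qₑ‖²≤‖Σ±qₑ‖² : ∀ {n k} (q : Fin k → Fin n → ℚ) →
  ∃ λ σ → Σℚ (λ e → ⟨ q e , q e ⟩) ≤ ⟨ signedSum σ q , signedSum σ q ⟩
∃-signs-Σ‖qₑ‖²≤‖Σ±qₑ‖² {n} {zero} q = (λ ()) , ℚP.≤-reflexive (sym (Σℚ-zero n))
∃-signs-Σ‖qₑ‖²≤‖Σ±qₑ‖² {n} {suc k} q
  with σ , ih ← ∃-signs-Σ‖qₑ‖²≤‖Σ±qₑ‖² (q ∘ suc)
  with x+y≡z+z⇒z≤x⊎z≤y {z = ⟨ q zero , q zero ⟩ + ⟨ p , p ⟩} (parallelogram-law p (q zero))
    where p = signedSum σ (q ∘ suc)
... | inj₁ X≤⟨v,v⟩ = true Vector.∷ σ , ℚP.≤-trans (ℚP.+-monoʳ-≤ ⟨ q zero , q zero ⟩ ih) X≤⟨v,v⟩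
... | inj₂ X≤⟨v,v⟩ = false Vector.∷ σ , ℚP.≤-trans (ℚP.+-monoʳ-≤ ⟨ q zero , q zero ⟩ ih) X≤⟨v,v⟩

bit : Bool → ℚ
bit b = if b then 1ℚ else 0ℚ

bit-bounded : ∀ b → 0ℚ ≤ bit b × bit b ≤ 1ℚ
bit-bounded true  = ℚP.≤ᵇ⇒≤ _ , ℚP.≤-refl
bit-bounded false = ℚP.≤-refl , ℚP.≤ᵇ⇒≤ _

when-difference-sq : ∀ {A B : Set} (a? : Dec A) (b? : Dec B) → ¬ (A × B) →
  (when a? 1ℚ - when b? 1ℚ) * (when a? 1ℚ - when b? 1ℚ) ≡ when a? 1ℚ + when b? 1ℚ
when-difference-sq (yes a) (yes b) ¬a×b = contradiction (a , b) ¬a×b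
when-difference-sq (yes _) (no _)  _    = refl
when-difference-sq (no _)  (yes _) _    = refl
when-difference-sq (no _)  (no _)  _    = refl

when-orientation-difference : ∀ {A B : Set} (a? : Dec A) (b? : Dec B) (c : Bool) →
  (when a? (bit c) + when b? (1ℚ - bit c)) - (when a? (bit (not c)) + when b? (1ℚ - bit (not c)))
  ≡ sign c * (when a? 1ℚ - when b? 1ℚ)
when-orientation-difference (yes _) (yes _) true  = refl
when-orientation-difference (yes _) (yes _) false = refl
when-orientation-difference (yes _) (no _)  true  = refl
when-orientation-difference (yes _) (no _)  false = refl
when-orientation-difference (no _)  (yes _) true  = refl
when-orientation-difference (no _)  (yes _) false = refl
when-orientation-difference (no _)  (no _)  true  = refl
when-orientation-difference (no _)  (no _)  false = refl

curvQuot-at-1 : ∀ {n} (x s : Fin n → ℚ) →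
  curvQuot x s 1ℚ ≡ ⟦ 2 ⟧ * ⟨ (λ u → s u - x u) , (λ u → s u - x u) ⟩
curvQuot-at-1 x s = cong (⟦ 2 ⟧ *_) (begin
  fObj y - fObj x - ⟨ (λ u → y u - x u) , ∇f x ⟩
    ≡⟨ cong (_- ⟨ (λ u → y u - x u) , ∇f x ⟩) (Σℚ-distrib-minus (λ u → y u * y u) (λ u → x u * x u)) ⟨
  Σℚ (λ u → y u * y u - x u * x u) - ⟨ (λ u → y u - x u) , ∇f x ⟩
    ≡⟨ Σℚ-distrib-minus (λ u → y u * y u - x u * x u) (λ u → (y u - x u) * ∇f x u) ⟨
  Σℚ (λ u → y u * y u - x u * x u - (y u - x u) * ∇f x u)
    ≡⟨ Σℚ-cong (λ u → solve 2 (λ x s →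
         (x :+ con 1ℚ :* (s :- x)) :* (x :+ con 1ℚ :* (s :- x)) :- x :* x
           :- ((x :+ con 1ℚ :* (s :- x)) :- x) :* (con ⟦ 2 ⟧ :* x)
         := (s :- x) :* (s :- x)) refl (x u) (s u)) ⟩
  ⟨ (λ u → s u - x u) , (λ u → s u - x u) ⟩ ∎)
  where
  open ≡-Reasoning
  open ℚ-Solver hiding (⟦_⟧)
  y = λ u → x u + 1ℚ * (s u - x u)

module _ {n} (G : Graph n) where

  src tgt : Fin (m G) → Fin n
  src e = proj₁ (ends G e)
  tgt e = proj₂ (ends G e)

  ¬bothEnds : ∀ e {u} → ¬ (src e ≡ u × tgt e ≡ u)
  ¬bothEnds e (src≡u , tgt≡u) = loopless G e (trans src≡u (sym tgt≡u))

  loadTerm : (Fin (m G) → ℚ) → Fin n → Fin (m G) → ℚ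
  loadTerm x u e = when (src e ≟ u) (x e) + when (tgt e ≟ u) (1ℚ - x e)

  incidence : Fin (m G) → Fin n → ℚ
  incidence e u = when (src e ≟ u) 1ℚ - when (tgt e ≟ u) 1ℚ

  incidence-‖‖² : ∀ e → ⟨ incidence e , incidence e ⟩ ≡ ⟦ 2 ⟧
  incidence-‖‖² e = begin
    ⟨ incidence e , incidence e ⟩
      ≡⟨ Σℚ-cong (λ u → when-difference-sq (src e ≟ u) (tgt e ≟ u) (¬bothEnds e)) ⟩
    Σℚ (λ u → when (src e ≟ u) 1ℚ + when (tgt e ≟ u) 1ℚ)
      ≡⟨ Σℚ-distrib-+ (λ u → when (src e ≟ u) 1ℚ) (λ u → when (tgt e ≟ u) 1ℚ) ⟩
    Σℚ (λ u → when (src e ≟ u) 1ℚ) + Σℚ (λ u → when (tgt e ≟ u) 1ℚ)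
      ≡⟨ cong₂ _+_ (Σℚ-select (src e) (λ _ → 1ℚ)) (Σℚ-select (tgt e) (λ _ → 1ℚ)) ⟩
    ⟦ 2 ⟧ ∎
    where open ≡-Reasoning

  orientedBy reversedBy : (Fin (m G) → Bool) → Fin n → ℚ
  orientedBy σ = loadOf G (bit ∘ σ)
  reversedBy σ = loadOf G (bit ∘ not ∘ σ)

  orientedBy∈𝒟 : ∀ σ → In𝒟 G (orientedBy σ)
  orientedBy∈𝒟 σ = bit ∘ σ , bit-bounded ∘ σ , λ _ → refl

  reversedBy∈𝒟 : ∀ σ → In𝒟 G (reversedBy σ)
  reversedBy∈𝒟 σ = bit ∘ not ∘ σ , bit-bounded ∘ not ∘ σ , λ _ → refl

  orientedBy-reversedBy : ∀ σ u → orientedBy σ u - reversedBy σ u ≡ signedSum σ incidence u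
  orientedBy-reversedBy σ u = trans (sym (Σℚ-distrib-minus (loadTerm (bit ∘ σ) u) (loadTerm (bit ∘ not ∘ σ) u)))
    (Σℚ-cong λ e → when-orientation-difference (src e ≟ u) (tgt e ≟ u) (σ e))

  4m≤curvature : ∀ C → CurvUpperBound G C → ⟦ 4 ⟧ * ⟦ m G ⟧ ≤ C
  4m≤curvature C C-bound with σ , Σ‖inc‖²≤‖Σinc‖² ← ∃-signs-Σ‖qₑ‖²≤‖Σ±qₑ‖² incidence = begin
    ⟦ 4 ⟧ * ⟦ m G ⟧                          ≡⟨ solve 1 (λ m → con ⟦ 4 ⟧ :* m := con ⟦ 2 ⟧ :* (m :* con ⟦ 2 ⟧)) refl ⟦ m G ⟧ ⟩
    ⟦ 2 ⟧ * (⟦ m G ⟧ * ⟦ 2 ⟧)                ≡⟨ cong (⟦ 2 ⟧ *_) (trans (Σℚ-cong incidence-‖‖²) (Σℚ-const (m G) ⟦ 2 ⟧)) ⟨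
    ⟦ 2 ⟧ * Σℚ (λ e → ⟨ incidence e , incidence e ⟩)
                                             ≤⟨ ℚP.*-monoˡ-≤-nonNeg ⟦ 2 ⟧ {{ℚ.nonNegative (⟦⟧-nonNeg 2)}} Σ‖inc‖²≤‖Σinc‖² ⟩
    ⟦ 2 ⟧ * ⟨ signedSum σ incidence , signedSum σ incidence ⟩
                                             ≡⟨ cong (⟦ 2 ⟧ *_) (Σℚ-cong λ u → cong₂ _*_ (orientedBy-reversedBy σ u) (orientedBy-reversedBy σ u)) ⟨
    ⟦ 2 ⟧ * ⟨ (λ u → s u - x u) , (λ u → s u - x u) ⟩
                                             ≡⟨ curvQuot-at-1 x s ⟨
    curvQuot x s 1ℚ                          ≤⟨ C-bound x s 1ℚ (reversedBy∈𝒟 σ) (orientedBy∈𝒟 σ) (ℚP.positive⁻¹ 1ℚ) ℚP.≤-refl ⟩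
    C                                        ∎
    where
    open ℚP.≤-Reasoning
    open ℚ-Solver hiding (⟦_⟧)
    x = reversedBy σ
    s = orientedBy σ

  Joins : Subset n → Fin n → Fin (m G) → Set
  Joins S u e = (src e ≡ u × tgt e ∈ S) ⊎ (tgt e ≡ u × src e ∈ S)

  joins? : ∀ S u e → Dec (Joins S u e)
  joins? S u e = (src e ≟ u ×-dec tgt e ∈? S) ⊎-dec (tgt e ≟ u ×-dec src e ∈? S)

  Within : Subset n → Fin (m G) → Set
  Within S e = src e ∈ S × tgt e ∈ S

  within? : ∀ S e → Dec (Within S e)
  within? S e = src e ∈? S ×-dec tgt e ∈? S

  joins⇒within : ∀ {S u e} → u ∈ S → Joins S u e → Within S e
  joins⇒within u∈S (inj₁ (src≡u , tgt∈S)) = subst (_∈ _) (sym src≡u) u∈S , tgt∈S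
  joins⇒within u∈S (inj₂ (tgt≡u , src∈S)) = src∈S , subst (_∈ _) (sym tgt≡u) u∈S

  joins⇒¬within∖ : ∀ {S u e} → Joins S u e → ¬ Within (S ∖ u) e
  joins⇒¬within∖ (inj₁ (src≡u , _)) (src∈S∖u , _) = x∈p∖y⇒x≢y src∈S∖u src≡u
  joins⇒¬within∖ (inj₂ (tgt≡u , _)) (_ , tgt∈S∖u) = x∈p∖y⇒x≢y tgt∈S∖u tgt≡u

  within∖⇒within : ∀ {S u e} → Within (S ∖ u) e → Within S e
  within∖⇒within {S} {u} = Product.map (p─q⊆p S ⁅ u ⁆) (p─q⊆p S ⁅ u ⁆)

  ¬joins⇒within⇒within∖ : ∀ {S u e} → ¬ Joins S u e → Within S e → Within (S ∖ u) e
  ¬joins⇒within⇒within∖ ¬joins (src∈S , tgt∈S) =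
    x∈p∧x≢y⇒x∈p-y src∈S (λ src≡u → ¬joins (inj₁ (src≡u , tgt∈S))) ,
    x∈p∧x≢y⇒x∈p-y tgt∈S (λ tgt≡u → ¬joins (inj₂ (tgt≡u , src∈S)))

  degIn≤deg : ∀ S u → degIn G S u ℕ.≤ deg G u
  degIn≤deg S u = Σℕ-mono-≤ λ e →
    indicator-mono (Sum.map (Product.map₂ (λ _ → ∈⊤)) (Product.map₂ (λ _ → ∈⊤))) (joins? S u e) (joins? ⊤ u e)

  Σ-over-ends : ∀ e (g : Fin n → ℚ) → Σℚ (λ u → when (joins? ⊤ u e) (g u)) ≡ g (src e) + g (tgt e)
  Σ-over-ends e g = begin
    Σℚ (λ u → when (joins? ⊤ u e) (g u))
      ≡⟨ Σℚ-cong (λ u → trans (when-cong (joins? ⊤ u e) (src e ≟ u ⊎-dec tgt e ≟ u) (Sum.map proj₁ proj₁) (Sum.map (_, ∈⊤) (_, ∈⊤)))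
                               (when-⊎-dec (src e ≟ u) (tgt e ≟ u) (¬bothEnds e))) ⟩
    Σℚ (λ u → when (src e ≟ u) (g u) + when (tgt e ≟ u) (g u))
      ≡⟨ Σℚ-distrib-+ (λ u → when (src e ≟ u) (g u)) (λ u → when (tgt e ≟ u) (g u)) ⟩
    Σℚ (λ u → when (src e ≟ u) (g u)) + Σℚ (λ u → when (tgt e ≟ u) (g u))
      ≡⟨ cong₂ _+_ (Σℚ-select (src e) g) (Σℚ-select (tgt e) g) ⟩
    g (src e) + g (tgt e) ∎
    where open ≡-Reasoning

  handshake : ∀ (g : Fin n → ℚ) → Σℚ (λ u → g u * ⟦ deg G u ⟧) ≡ Σℚ (λ e → g (src e) + g (tgt e))
  handshake g = begin
    Σℚ (λ u → g u * ⟦ deg G u ⟧)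
      ≡⟨ Σℚ-cong (λ u → trans (cong (g u *_) (⟦Σℕ⟧ (indicator u))) (sym (*-distribˡ-Σℚ (g u) (λ e → ⟦ indicator u e ⟧)))) ⟩
    Σℚ (λ u → Σℚ (λ e → g u * ⟦ indicator u e ⟧))
      ≡⟨ Σℚ-swap (λ u e → g u * ⟦ indicator u e ⟧) ⟩
    Σℚ (λ e → Σℚ (λ u → g u * ⟦ indicator u e ⟧))
      ≡⟨ Σℚ-cong (λ e → trans (Σℚ-cong (λ u → *-⟦indicator⟧ (joins? ⊤ u e) (g u))) (Σ-over-ends e g)) ⟩
    Σℚ (λ e → g (src e) + g (tgt e)) ∎
    where
    open ≡-Reasoning
    indicator : Fin n → Fin (m G) → ℕ
    indicator u e = if does (joins? ⊤ u e) then 1 else 0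

  squaredDegreeSum : ℕ
  squaredDegreeSum = Σℕ λ u → deg G u ℕ.* deg G u

  ⟦squaredDegreeSum⟧ : ⟦ squaredDegreeSum ⟧ ≡ Σℚ (λ e → ⟦ deg G (src e) ⟧ + ⟦ deg G (tgt e) ⟧)
  ⟦squaredDegreeSum⟧ = trans (⟦Σℕ⟧ (λ u → deg G u ℕ.* deg G u))
    (trans (Σℚ-cong (λ u → ⟦⟧-homo-* (deg G u) (deg G u))) (handshake (λ u → ⟦ deg G u ⟧)))

  Σ-weighted-loadTerm : ∀ (w : Fin n → ℚ) x e →
    Σℚ (λ u → w u * loadTerm x u e) ≡ w (src e) * x e + w (tgt e) * (1ℚ - x e)
  Σ-weighted-loadTerm w x e = begin
    Σℚ (λ u → w u * loadTerm x u e)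
      ≡⟨ Σℚ-cong (λ u → trans (ℚP.*-distribˡ-+ (w u) _ _)
                          (cong₂ _+_ (*-when (src e ≟ u) (w u) (x e)) (*-when (tgt e ≟ u) (w u) (1ℚ - x e)))) ⟩
    Σℚ (λ u → when (src e ≟ u) (w u * x e) + when (tgt e ≟ u) (w u * (1ℚ - x e)))
      ≡⟨ Σℚ-distrib-+ (λ u → when (src e ≟ u) (w u * x e)) (λ u → when (tgt e ≟ u) (w u * (1ℚ - x e))) ⟩
    Σℚ (λ u → when (src e ≟ u) (w u * x e)) + Σℚ (λ u → when (tgt e ≟ u) (w u * (1ℚ - x e)))
      ≡⟨ cong₂ _+_ (Σℚ-select (src e) (λ u → w u * x e)) (Σℚ-select (tgt e) (λ u → w u * (1ℚ - x e))) ⟩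
    w (src e) * x e + w (tgt e) * (1ℚ - x e) ∎
    where open ≡-Reasoning

  ⟨,⟩-loadOf : ∀ (w : Fin n → ℚ) x → ⟨ w , loadOf G x ⟩ ≡ Σℚ (λ e → w (src e) * x e + w (tgt e) * (1ℚ - x e))
  ⟨,⟩-loadOf w x = begin
    Σℚ (λ u → w u * Σℚ (loadTerm x u))          ≡⟨ Σℚ-cong (λ u → *-distribˡ-Σℚ (w u) (loadTerm x u)) ⟨
    Σℚ (λ u → Σℚ (λ e → w u * loadTerm x u e))  ≡⟨ Σℚ-swap (λ u e → w u * loadTerm x u e) ⟩
    Σℚ (λ e → Σℚ (λ u → w u * loadTerm x u e))  ≡⟨ Σℚ-cong (Σ-weighted-loadTerm w x) ⟩
    Σℚ (λ e → w (src e) * x e + w (tgt e) * (1ℚ - x e)) ∎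
    where open ≡-Reasoning

module _ {n} (G : Graph n) (w : Fin n → ℚ) where

  Minimises : Subset n → Fin n → Set
  Minimises S u = ∀ v → v ∈ S → w u + ⟦ degIn G S u ⟧ ≤ w v + ⟦ degIn G S v ⟧

  minimiser-bound : ∀ {S u v} → Minimises S u → v ∈ S → w u ≤ w v + ⟦ deg G v ⟧
  minimiser-bound {S} {u} {v} min v∈S = begin
    w u                        ≤⟨ p≤p+q (⟦⟧-nonNeg (degIn G S u)) ⟩
    w u + ⟦ degIn G S u ⟧      ≤⟨ min v v∈S ⟩
    w v + ⟦ degIn G S v ⟧      ≤⟨ ℚP.+-monoʳ-≤ (w v) (⟦⟧-mono-≤ (degIn≤deg G S v)) ⟩
    w v + ⟦ deg G v ⟧          ∎
    where open ℚP.≤-Reasoning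

  cost : ℚ → Fin n → Fin n → ℚ
  cost t a b = w a * t + w b * (1ℚ - t) + (⟦ deg G a ⟧ + ⟦ deg G b ⟧)

  0≤deg+deg : ∀ a b → 0ℚ ≤ ⟦ deg G a ⟧ + ⟦ deg G b ⟧
  0≤deg+deg a b = ℚP.+-mono-≤ (⟦⟧-nonNeg (deg G a)) (⟦⟧-nonNeg (deg G b))

  minimiser≤cost : ∀ {S u t a b} → Minimises S u → 0ℚ ≤ t → t ≤ 1ℚ →
                   (a ≡ u × b ∈ S) ⊎ (b ≡ u × a ∈ S) → w u ≤ cost t a b
  minimiser≤cost {u = u} {t} {b = b} min 0≤t t≤1 (inj₁ (refl , b∈S)) =
    ≤-convex {q = w b} 0≤t (p≤q⇒0≤q-p t≤1) (t+[1-t]≡1 t) (0≤deg+deg u b) (begin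
      w u                                ≤⟨ minimiser-bound min b∈S ⟩
      w b + ⟦ deg G b ⟧                  ≤⟨ ℚP.+-monoʳ-≤ (w b) (q≤p+q (⟦⟧-nonNeg (deg G u))) ⟩
      w b + (⟦ deg G u ⟧ + ⟦ deg G b ⟧)  ∎)
    where open ℚP.≤-Reasoning
  minimiser≤cost {u = u} {t} {a} min 0≤t t≤1 (inj₂ (refl , a∈S)) =
    subst (w u ≤_) (cong (_+ (⟦ deg G a ⟧ + ⟦ deg G u ⟧)) (ℚP.+-comm (w u * (1ℚ - t)) (w a * t)))
      (≤-convex {q = w a} (p≤q⇒0≤q-p t≤1) 0≤t (trans (ℚP.+-comm (1ℚ - t) t) (t+[1-t]≡1 t)) (0≤deg+deg a u) (begin
        w u                                ≤⟨ minimiser-bound min a∈S ⟩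
        w a + ⟦ deg G a ⟧                  ≤⟨ ℚP.+-monoʳ-≤ (w a) (p≤p+q (⟦⟧-nonNeg (deg G u))) ⟩
        w a + (⟦ deg G a ⟧ + ⟦ deg G u ⟧)  ∎))
    where open ℚP.≤-Reasoning

  ⟨,⟩-record : ∀ (acc : Fin n → ℚ) u D → acc u ≡ 0ℚ →
               ⟨ w , (λ v → if does (v ≟ u) then D else acc v) ⟩ ≡ ⟨ w , acc ⟩ + w u * D
  ⟨,⟩-record acc u D acc[u]≡0 = begin
    ⟨ w , (λ v → if does (v ≟ u) then D else acc v) ⟩
      ≡⟨ Σℚ-cong term ⟩
    Σℚ (λ v → w v * acc v + when (u ≟ v) (w v * D))
      ≡⟨ Σℚ-distrib-+ (λ v → w v * acc v) (λ v → when (u ≟ v) (w v * D)) ⟩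
    ⟨ w , acc ⟩ + Σℚ (λ v → when (u ≟ v) (w v * D))
      ≡⟨ cong (_+_ ⟨ w , acc ⟩) (Σℚ-select u (λ v → w v * D)) ⟩
    ⟨ w , acc ⟩ + w u * D ∎
    where
    open ≡-Reasoning
    term : ∀ v → w v * (if does (v ≟ u) then D else acc v) ≡ w v * acc v + when (u ≟ v) (w v * D)
    term v with v ≟ u | u ≟ v
    ... | yes refl | yes _   = sym (begin
      w u * acc u + w u * D  ≡⟨ cong (λ a → w u * a + w u * D) acc[u]≡0 ⟩
      w u * 0ℚ + w u * D     ≡⟨ cong (_+ w u * D) (ℚP.*-zeroʳ (w u)) ⟩
      0ℚ + w u * D           ≡⟨ ℚP.+-identityˡ (w u * D) ⟩
      w u * D                ∎)
    ... | yes v≡u  | no u≢v  = contradiction (sym v≡u) u≢v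
    ... | no v≢u   | yes u≡v = contradiction (sym u≡v) v≢u
    ... | no _     | no _    = sym (ℚP.+-identityʳ (w v * acc v))

  module _ (x : Fin (m G) → ℚ) (x-valid : ValidOrientation G x) where

    potential : Subset n → ℚ
    potential S = Σℚ λ e → when (within? G S e) (cost (x e) (src G e) (tgt G e))

    ∣S∣≤1⇒potential≡0 : ∀ {S} → ∣ S ∣ ℕ.≤ 1 → potential S ≡ 0ℚ
    ∣S∣≤1⇒potential≡0 {S} ∣S∣≤1 = trans (Σℚ-cong λ e → when-no (within? G S e) (¬within e)) (Σℚ-zero (m G))
      where
      ¬within : ∀ e → ¬ Within G S e
      ¬within e (src∈S , tgt∈S) = ℕP.<⇒≱ (distinct-members⇒1<∣p∣ src∈S tgt∈S (loopless G e)) ∣S∣≤1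

    potential-⊤ : potential ⊤ ≡ ⟨ w , loadOf G x ⟩ + ⟦ squaredDegreeSum G ⟧
    potential-⊤ = begin
      potential ⊤
        ≡⟨ Σℚ-cong (λ e → when-yes (within? G ⊤ e) (∈⊤ , ∈⊤)) ⟩
      Σℚ (λ e → cost (x e) (src G e) (tgt G e))
        ≡⟨ Σℚ-distrib-+ (λ e → w (src G e) * x e + w (tgt G e) * (1ℚ - x e)) (λ e → ⟦ deg G (src G e) ⟧ + ⟦ deg G (tgt G e) ⟧) ⟩
      Σℚ (λ e → w (src G e) * x e + w (tgt G e) * (1ℚ - x e)) + Σℚ (λ e → ⟦ deg G (src G e) ⟧ + ⟦ deg G (tgt G e) ⟧)
        ≡⟨ cong₂ _+_ (⟨,⟩-loadOf G w x) (⟦squaredDegreeSum⟧ G) ⟨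
      ⟨ w , loadOf G x ⟩ + ⟦ squaredDegreeSum G ⟧ ∎
      where open ≡-Reasoning

    potential-step-edge : ∀ {S u} → Minimises S u → u ∈ S → ∀ e →
      when (joins? G S u e) (w u) + when (within? G (S ∖ u) e) (cost (x e) (src G e) (tgt G e))
        ≤ when (within? G S e) (cost (x e) (src G e) (tgt G e))
    potential-step-edge {S} {u} min u∈S e = by-joins (joins? G S u e)
      where
      open ℚP.≤-Reasoning
      c = cost (x e) (src G e) (tgt G e)
      by-joins : (joins? : Dec (Joins G S u e)) →
                 when joins? (w u) + when (within? G (S ∖ u) e) c ≤ when (within? G S e) c
      by-joins (yes joins) = begin
        w u + when (within? G (S ∖ u) e) c  ≡⟨ cong (_+_ (w u)) (when-no (within? G (S ∖ u) e) (joins⇒¬within∖ G joins)) ⟩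
        w u + 0ℚ                            ≡⟨ ℚP.+-identityʳ (w u) ⟩
        w u                                 ≤⟨ minimiser≤cost min (proj₁ (x-valid e)) (proj₂ (x-valid e)) joins ⟩
        c                                   ≡⟨ when-yes (within? G S e) (joins⇒within G u∈S joins) ⟨
        when (within? G S e) c              ∎
      by-joins (no ¬joins) = ℚP.≤-reflexive (trans (ℚP.+-identityˡ _)
        (when-cong (within? G (S ∖ u) e) (within? G S e) (within∖⇒within G) (¬joins⇒within⇒within∖ G ¬joins)))

    potential-step : ∀ {S u} → Minimises S u → u ∈ S → w u * ⟦ degIn G S u ⟧ + potential (S ∖ u) ≤ potential S
    potential-step {S} {u} min u∈S = begin
      w u * ⟦ degIn G S u ⟧ + potential (S ∖ u)
        ≡⟨ cong (_+ potential (S ∖ u)) (trans (cong (w u *_) (⟦Σℕ⟧ indicator)) (sym (*-distribˡ-Σℚ (w u) (⟦_⟧ ∘ indicator)))) ⟩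
      Σℚ (λ e → w u * ⟦ indicator e ⟧) + potential (S ∖ u)
        ≡⟨ cong (_+ potential (S ∖ u)) (Σℚ-cong λ e → *-⟦indicator⟧ (joins? G S u e) (w u)) ⟩
      Σℚ (λ e → when (joins? G S u e) (w u)) + potential (S ∖ u)
        ≡⟨ Σℚ-distrib-+ (λ e → when (joins? G S u e) (w u)) (λ e → when (within? G (S ∖ u) e) (cost (x e) (src G e) (tgt G e))) ⟨
      Σℚ (λ e → when (joins? G S u e) (w u) + when (within? G (S ∖ u) e) (cost (x e) (src G e) (tgt G e)))
        ≤⟨ Σℚ-mono-≤ (potential-step-edge min u∈S) ⟩
      potential S ∎
      where
      open ℚP.≤-Reasoning
      indicator : Fin (m G) → ℕ
      indicator e = if does (joins? G S u e) then 1 else 0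

    greedy-invariant : ∀ {S acc out} → Greedy G w S acc out → (∀ v → v ∈ S → acc v ≡ 0ℚ) →
                       ⟨ w , out ⟩ ≤ ⟨ w , acc ⟩ + potential S
    greedy-invariant {S} {acc} {out} (done ∣S∣≤1 out≡acc) _ = ℚP.≤-reflexive (begin
      ⟨ w , out ⟩                ≡⟨ Σℚ-cong (λ v → cong (w v *_) (out≡acc v)) ⟩
      ⟨ w , acc ⟩                ≡⟨ ℚP.+-identityʳ ⟨ w , acc ⟩ ⟨
      ⟨ w , acc ⟩ + 0ℚ           ≡⟨ cong (_+_ ⟨ w , acc ⟩) (∣S∣≤1⇒potential≡0 ∣S∣≤1) ⟨
      ⟨ w , acc ⟩ + potential S  ∎)
      where open ≡-Reasoning
    greedy-invariant {S} {acc} {out} (step u _ u∈S min run) acc≡0 = begin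
      ⟨ w , out ⟩
        ≤⟨ greedy-invariant run (update-vanishes-on-∖ acc D acc≡0) ⟩
      ⟨ w , acc′ ⟩ + potential (S ∖ u)
        ≡⟨ cong (_+ potential (S ∖ u)) (⟨,⟩-record acc u D (acc≡0 u u∈S)) ⟩
      ⟨ w , acc ⟩ + w u * D + potential (S ∖ u)
        ≡⟨ ℚP.+-assoc ⟨ w , acc ⟩ (w u * D) (potential (S ∖ u)) ⟩
      ⟨ w , acc ⟩ + (w u * D + potential (S ∖ u))
        ≤⟨ ℚP.+-monoʳ-≤ ⟨ w , acc ⟩ (potential-step min u∈S) ⟩
      ⟨ w , acc ⟩ + potential S ∎
      where
      open ℚP.≤-Reasoning
      D = ⟦ degIn G S u ⟧
      acc′ = λ v → if does (v ≟ u) then D else acc v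

greedy-additive-error : ∀ {n} (G : Graph n) (w : Fin n → ℚ) {d̂ d} → IsWeightedGreedy G w d̂ → In𝒟 G d →
                        ⟨ w , d̂ ⟩ ≤ ⟨ w , d ⟩ + ⟦ squaredDegreeSum G ⟧
greedy-additive-error {n} G w {d̂} {d} greedy (x , x-valid , d≡load) = begin
  ⟨ w , d̂ ⟩                                       ≤⟨ greedy-invariant G w x x-valid greedy (λ _ _ → refl) ⟩
  ⟨ w , (λ _ → 0ℚ) ⟩ + potential G w x x-valid ⊤  ≡⟨ cong₂ _+_ (trans (Σℚ-cong (λ v → ℚP.*-zeroʳ (w v))) (Σℚ-zero n)) (potential-⊤ G w x x-valid) ⟩
  0ℚ + (⟨ w , loadOf G x ⟩ + ⟦ squaredDegreeSum G ⟧)  ≡⟨ ℚP.+-identityˡ _ ⟩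
  ⟨ w , loadOf G x ⟩ + ⟦ squaredDegreeSum G ⟧     ≡⟨ cong (λ z → z + ⟦ squaredDegreeSum G ⟧) (Σℚ-cong λ v → cong (w v *_) (sym (d≡load v))) ⟩
  ⟨ w , d ⟩ + ⟦ squaredDegreeSum G ⟧             ∎
  where open ℚP.≤-Reasoning

⟨,⟩-scaleˡ : ∀ {n} (c : ℚ) (b v : Fin n → ℚ) → ⟨ (λ u → c * b u) , v ⟩ ≡ c * ⟨ b , v ⟩
⟨,⟩-scaleˡ c b v = trans (Σℚ-cong λ u → ℚP.*-assoc c (b u) (v u)) (*-distribˡ-Σℚ c (λ u → b u * v u))

⟦2+k⟧*[1/2+k]≡1 : ∀ k → ⟦ suc (suc k) ⟧ * (+ 1 / suc (suc k)) ≡ 1ℚ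
⟦2+k⟧*[1/2+k]≡1 k = trans
  (cong₂ _*_ (ℚP.normalize-coprime (coprime-sym (1-coprimeTo (suc (suc k)))))
             (ℚP.normalize-coprime (1-coprimeTo (suc (suc k)))))
  (ℚP.*-inverseʳ (ℚ.mkℚ (+ suc (suc k)) 0 (coprime-sym (1-coprimeTo (suc (suc k))))))

scaled-error⇒step-error : ∀ k {L R Q D} → 0ℚ ≤ Q → ⟦ 4 ⟧ * Q ≤ D →
  ⟦ suc k ⟧ * L ≤ ⟦ suc k ⟧ * R + Q → L ≤ R + D * (+ 1 / suc (suc k))
scaled-error⇒step-error k {L} {R} {Q} {D} 0≤Q 4Q≤D KL≤KR+Q =
  ℚP.*-cancelˡ-≤-pos K {{⟦⟧-pos (suc k)}} (begin
    K * L                ≤⟨ KL≤KR+Q ⟩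
    K * R + Q            ≤⟨ ℚP.+-monoʳ-≤ (K * R) Q≤K[Dt] ⟩
    K * R + K * (D * t)  ≡⟨ ℚP.*-distribˡ-+ K R (D * t) ⟨
    K * (R + D * t)      ∎)
  where
  open ℚP.≤-Reasoning
  K = ⟦ suc k ⟧
  t = + 1 / suc (suc k)
  0≤t : 0ℚ ≤ t
  0≤t = ℚP.nonNegative⁻¹ t {{ℚP.normalize-nonNeg 1 (suc (suc k))}}
  2+k≤4[1+k] : 2 ℕ.+ k ℕ.≤ 4 ℕ.* suc k
  2+k≤4[1+k] = subst (2 ℕ.+ k ℕ.≤_) (solve 1 (λ k → (con 2 :+ k) :+ (con 2 :+ con 3 :* k) := con 4 :* (con 1 :+ k)) refl k)
                     (ℕP.m≤m+n (2 ℕ.+ k) (2 ℕ.+ 3 ℕ.* k))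
    where open ℕ-Solver
  Q≤K[Dt] : Q ≤ K * (D * t)
  Q≤K[Dt] = begin
    Q                           ≡⟨ trans (cong (Q *_) (⟦2+k⟧*[1/2+k]≡1 k)) (ℚP.*-identityʳ Q) ⟨
    Q * (⟦ 2 ℕ.+ k ⟧ * t)       ≤⟨ ℚP.*-monoˡ-≤-nonNeg Q {{ℚ.nonNegative 0≤Q}}
                                     (ℚP.*-monoʳ-≤-nonNeg t {{ℚ.nonNegative 0≤t}} (⟦⟧-mono-≤ 2+k≤4[1+k])) ⟩
    Q * (⟦ 4 ℕ.* suc k ⟧ * t)   ≡⟨ cong (λ z → Q * (z * t)) (⟦⟧-homo-* 4 (suc k)) ⟩
    Q * ((⟦ 4 ⟧ * K) * t)       ≡⟨ solve 3 (λ Q K t → Q :* ((con ⟦ 4 ⟧ :* K) :* t) := K :* ((con ⟦ 4 ⟧ :* Q) :* t)) refl Q K t ⟩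
    K * ((⟦ 4 ⟧ * Q) * t)       ≤⟨ ℚP.*-monoˡ-≤-nonNeg K {{ℚ.nonNegative (⟦⟧-nonNeg (suc k))}}
                                     (ℚP.*-monoʳ-≤-nonNeg t {{ℚ.nonNegative 0≤t}} 4Q≤D) ⟩
    K * (D * t)                 ∎
    where open ℚ-Solver hiding (⟦_⟧)

module _ {n} (G : Graph n) .{{_ : ℕ.NonZero (m G)}} where

  private instance
    ⟦m⟧≢0 : ℚ.NonZero ⟦ m G ⟧
    ⟦m⟧≢0 = ℚP.pos⇒nonZero ⟦ m G ⟧ {{⟦⟧-pos (m G)}}

  degreeRatio : ℚ
  degreeRatio = ⟦ squaredDegreeSum G ⟧ * ℚ.1/ ⟦ m G ⟧

  degreeRatio*m : degreeRatio * ⟦ m G ⟧ ≡ ⟦ squaredDegreeSum G ⟧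
  degreeRatio*m = begin
    ⟦ squaredDegreeSum G ⟧ * ℚ.1/ ⟦ m G ⟧ * ⟦ m G ⟧    ≡⟨ ℚP.*-assoc ⟦ squaredDegreeSum G ⟧ (ℚ.1/ ⟦ m G ⟧) ⟦ m G ⟧ ⟩
    ⟦ squaredDegreeSum G ⟧ * (ℚ.1/ ⟦ m G ⟧ * ⟦ m G ⟧)  ≡⟨ cong (⟦ squaredDegreeSum G ⟧ *_) (ℚP.*-inverseˡ ⟦ m G ⟧) ⟩
    ⟦ squaredDegreeSum G ⟧ * 1ℚ                         ≡⟨ ℚP.*-identityʳ ⟦ squaredDegreeSum G ⟧ ⟩
    ⟦ squaredDegreeSum G ⟧                              ∎
    where open ≡-Reasoning

  4Σdeg²≤degreeRatio*curvature : ∀ C → CurvUpperBound G C → ⟦ 4 ⟧ * ⟦ squaredDegreeSum G ⟧ ≤ degreeRatio * C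
  4Σdeg²≤degreeRatio*curvature C C-bound = begin
    ⟦ 4 ⟧ * ⟦ squaredDegreeSum G ⟧          ≡⟨ cong (⟦ 4 ⟧ *_) degreeRatio*m ⟨
    ⟦ 4 ⟧ * (degreeRatio * ⟦ m G ⟧)         ≡⟨ solve 2 (λ δ M → con ⟦ 4 ⟧ :* (δ :* M) := δ :* (con ⟦ 4 ⟧ :* M)) refl degreeRatio ⟦ m G ⟧ ⟩
    degreeRatio * (⟦ 4 ⟧ * ⟦ m G ⟧)         ≤⟨ ℚP.*-monoˡ-≤-nonNeg degreeRatio {{ℚ.nonNegative 0≤δ}} (4m≤curvature G C C-bound) ⟩
    degreeRatio * C                          ∎
    where
    open ℚP.≤-Reasoning
    open ℚ-Solver hiding (⟦_⟧)
    0≤δ : 0ℚ ≤ degreeRatio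
    0≤δ = *-nonNeg (⟦⟧-nonNeg (squaredDegreeSum G)) (ℚP.<⇒≤ (ℚP.positive⁻¹ _ {{ℚP.1/pos⇒pos ⟦ m G ⟧ {{⟦⟧-pos (m G)}}}}))

  greedy-step-error : ∀ C → CurvUpperBound G C → ∀ k (b d̂ d : Fin n → ℚ) →
    IsWeightedGreedy G (λ u → ⟦ suc k ⟧ * b u) d̂ → In𝒟 G d →
    ⟨ b , d̂ ⟩ ≤ ⟨ b , d ⟩ + degreeRatio * C * (+ 1 / suc (suc k))
  greedy-step-error C C-bound k b d̂ d greedy d∈𝒟 =
    scaled-error⇒step-error k (⟦⟧-nonNeg (squaredDegreeSum G)) (4Σdeg²≤degreeRatio*curvature C C-bound)
      (subst₂ _≤_ (⟨,⟩-scaleˡ K b d̂) (cong (_+ ⟦ squaredDegreeSum G ⟧) (⟨,⟩-scaleˡ K b d))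
        (greedy-additive-error G (λ u → K * b u) greedy d∈𝒟))
    where K = ⟦ suc k ⟧

lemma10 : Σ ℚ λ c₁ → Σ ℚ λ c₂ → (0ℚ < c₁) × (0ℚ < c₂) ×
    (∀ {n} (G : Graph n) → 1 ℕ.≤ m G →
      let S = ⟦ Σℕ (λ u → deg G u ℕ.* deg G u) ⟧ in
      Σ ℚ λ δ → (c₁ * S ≤ δ * ⟦ m G ⟧) × (δ * ⟦ m G ⟧ ≤ c₂ * S) ×
        (∀ (C : ℚ) → IsCurvatureConstant G C →
         ∀ (b d : ℕ → Fin n → ℚ) →
         IsWeightedGreedy G (λ _ → 0ℚ) (b 0) →
         (∀ k → IsWeightedGreedy G (λ u → ⟦ suc k ⟧ * b k u) (d (suc k))) →
         (∀ k u → b (suc k) u ≡ (1ℚ - + 1 / suc k) * b k u + (+ 1 / suc k) * d (suc k) u) →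
         ∀ (k : ℕ) (d' : Fin n → ℚ) → In𝒟 G d' →
           ⟨ b k , d (suc k) ⟩ ≤ ⟨ b k , d' ⟩ + δ * C * (+ 1 / suc (suc k))))
lemma10 = 1ℚ , 1ℚ , 0<1 , 0<1 , λ G 1≤m → let instance m≢0 = ℕ.>-nonZero 1≤m in
  degreeRatio G ,
  ℚP.≤-reflexive (trans (ℚP.*-identityˡ _) (sym (degreeRatio*m G))) ,
  ℚP.≤-reflexive (trans (degreeRatio*m G) (sym (ℚP.*-identityˡ _))) ,
  λ C C-curvature b d _ d-greedy _ k d' d'∈𝒟 →
    greedy-step-error G C (proj₁ C-curvature) k (b k) (d (suc k)) d' (d-greedy k) d'∈𝒟
  where
  0<1 : 0ℚ < 1ℚ
  0<1 = ℚP.positive⁻¹ 1ℚ
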